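{- There exists a $3$-uniform hypergraph $H_2$ with no isolated vertices which has no strongly minimal edge-cover.
   Context: A hypergraph $H$ consists of a (possibly infinite) vertex set $V$ and a set $E$ of edges, each a subset of $V$; it is $3$-uniform if every edge has exactly $3$ vertices. A vertex is isolated if it lies in no edge. An edge-cover is a set $C\subseteq E$ of edges whose union is $V$. An edge-cover $C$ is strongly minimal if for every edge-cover $C'$ of $H$ we have $|C\setminus C'|\leq |C'\setminus C|$ (comparison of cardinalities). -}

module Defs where

open import Data.Product using (Σ; ∃; _×_; _,_; proj₁)
open import Data.Sum using (_⊎_)
open import Relation.Binary.PropositionalEquality using (_≡_; _≢_)
open import Relation.Nullary using (¬_)
open import Function.Bundles using (_⇔_)

-- Edges are subsets of V, so two edges with the same vertex set are equal.
record Hypergraph : Set₁ where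
  field
    V    : Set
    E    : Set
    _∈ₕ_ : V → E → Set
    edges-are-sets : ∀ e e' → (∀ v → (v ∈ₕ e) ⇔ (v ∈ₕ e')) → e ≡ e'

open Hypergraph public

ThreeUniform : Hypergraph → Set
ThreeUniform H = ∀ e → Σ (V H) λ a → Σ (V H) λ b → Σ (V H) λ c →
  (a ≢ b) × (a ≢ c) × (b ≢ c) ×
  (∀ v → (_∈ₕ_ H v e) ⇔ ((v ≡ a) ⊎ (v ≡ b) ⊎ (v ≡ c)))

Isolated : (H : Hypergraph) → V H → Set
Isolated H v = ¬ (Σ (E H) λ e → _∈ₕ_ H v e)

NoIsolated : Hypergraph → Set
NoIsolated H = ∀ v → Σ (E H) λ e → _∈ₕ_ H v e

EdgeSet : Hypergraph → Set₁
EdgeSet H = E H → Set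

IsEdgeCover : (H : Hypergraph) → EdgeSet H → Set
IsEdgeCover H C = ∀ v → Σ (E H) λ e → C e × _∈ₕ_ H v e

-- |C ∖ C'| ≤ |C' ∖ C| : there is an injection from C ∖ C' into C' ∖ C.
DiffLeq : (H : Hypergraph) → EdgeSet H → EdgeSet H → Set
DiffLeq H C C' =
  Σ ((e : E H) → C e → ¬ C' e → Σ (E H) λ e' → C' e' × ¬ C e') λ f →
    ∀ e₁ p₁ q₁ e₂ p₂ q₂ → proj₁ (f e₁ p₁ q₁) ≡ proj₁ (f e₂ p₂ q₂) → e₁ ≡ e₂

IsStronglyMinimal : (H : Hypergraph) → EdgeSet H → Set₁
IsStronglyMinimal H C = IsEdgeCover H C × (∀ C' → IsEdgeCover H C' → DiffLeq H C C')

-- The vertices S i d and T i d sit on the diagonal n = i + d, and the edges A i d, B i d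
-- of level n = i + d are the only edges through T i d; hence every edge-cover C has at
-- least n + 1 edges on each level n.  If C also contains some B i d, then either B i d is
-- a second edge through T i d, or S i d forces a further edge of the same level, possibly
-- after walking down the diagonal through B (i - 1) (d + 1); so level i + d carries at
-- least n + 2 edges of C.  Covering U 0 and U (d₀ + 1) yields two such levels n₀ < n₁.
-- Replacing all edges of C on these two levels by the n₀ + 1 A-edges of level n₀, the
-- n₁ + 1 B-edges of level n₁ and A 0 n₁ gives another edge-cover C'.  An injection
-- C ∖ C' → C' ∖ C would then inject the n₀ + n₁ + 4 edges of C on the two levels into
-- these n₀ + n₁ + 3 replacement edges.
module Submission where

open import Defs
open import Data.Nat using (ℕ; zero; suc; _+_; _∸_; _≤_; _<_; s≤s)
open import Data.Nat.Properties
  using (_≟_; +-suc; +-identityʳ; m≤m+n; m+n∸m≡n; m+[n∸m]≡n; ≤-trans; ≤-reflexive; ≤-pred; <⇒≤; <⇒≢; n≮n)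
open import Data.Fin using (Fin; toℕ; fromℕ<; splitAt; join; _↑ˡ_; _↑ʳ_) renaming (zero to fzero; suc to fsuc)
open import Data.Fin.Properties using (toℕ-injective; toℕ-fromℕ<; toℕ<n; join-splitAt; injective⇒≤)
open import Data.Vec.Functional using (Vector; _∷_; _++_)
open import Data.Vec.Functional.Properties using (lookup-++ˡ; lookup-++ʳ)
open import Data.Vec.Functional.Relation.Unary.Any using (Any; any; there)
open import Data.Vec.Functional.Relation.Unary.All.Properties using (++⁺)
open import Data.Product using (Σ; _×_; _,_; proj₁; proj₂; uncurry; map₁; map₂)
open import Data.Product.Properties using (≡-dec)
open import Data.Sum using (_⊎_; inj₁; inj₂; [_,_]; [_,_]′)
open import Function using (_∘_; id)
open import Function.Bundles using (_⇔_; mk⇔; Equivalence)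
open import Function.Definitions using (Injective)
open import Relation.Nullary using (¬_; yes; no; contradiction)
open import Relation.Nullary.Decidable using (map′)
open import Relation.Binary.Definitions using (DecidableEquality)
open import Relation.Binary.PropositionalEquality using (_≡_; _≢_; refl; sym; trans; cong; cong₂; subst)

infix 4 _∈ᵛ_

_∈ᵛ_ : {A : Set} {n : ℕ} → A → Vector A n → Set
x ∈ᵛ xs = Any (x ≡_) xs

∈ᵛ-++⁺ˡ : {A : Set} {m n : ℕ} {x : A} {xs : Vector A m} (ys : Vector A n) →
          x ∈ᵛ xs → x ∈ᵛ xs ++ ys
∈ᵛ-++⁺ˡ {xs = xs} ys (i , x≡xsᵢ) = i ↑ˡ _ , trans x≡xsᵢ (sym (lookup-++ˡ xs ys i))

∈ᵛ-++⁺ʳ : {A : Set} {m n : ℕ} {x : A} (xs : Vector A m) {ys : Vector A n} →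
          x ∈ᵛ ys → x ∈ᵛ xs ++ ys
∈ᵛ-++⁺ʳ {m = m} xs {ys} (i , x≡ysᵢ) = m ↑ʳ i , trans x≡ysᵢ (sym (lookup-++ʳ xs ys i))

injective-∷ : {A : Set} {n : ℕ} {x : A} {xs : Vector A n} →
              (∀ i → x ≢ xs i) → Injective _≡_ _≡_ xs → Injective _≡_ _≡_ (x ∷ xs)
injective-∷ fresh xs-inj {fzero}  {fzero}  _  = refl
injective-∷ fresh xs-inj {fzero}  {fsuc j} eq = contradiction eq (fresh j)
injective-∷ fresh xs-inj {fsuc i} {fzero}  eq = contradiction (sym eq) (fresh i)
injective-∷ fresh xs-inj {fsuc i} {fsuc j} eq = cong fsuc (xs-inj eq)

injective-++ : {A : Set} {m n : ℕ} {xs : Vector A m} {ys : Vector A n} →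
               Injective _≡_ _≡_ xs → Injective _≡_ _≡_ ys → (∀ i j → xs i ≢ ys j) →
               Injective _≡_ _≡_ (xs ++ ys)
injective-++ {m = m} {n} {xs} {ys} xs-inj ys-inj disjoint {a} {b} eq =
  trans (sym (join-splitAt m n a))
        (trans (cong (join m n) (sides-injective (splitAt m a) (splitAt m b) eq))
               (join-splitAt m n b))
  where
  sides-injective : ∀ s t → [ xs , ys ] s ≡ [ xs , ys ] t → s ≡ t
  sides-injective (inj₁ i) (inj₁ j) eq = cong inj₁ (xs-inj eq)
  sides-injective (inj₁ i) (inj₂ j) eq = contradiction eq (disjoint i j)
  sides-injective (inj₂ i) (inj₁ j) eq = contradiction (sym eq) (disjoint j i)
  sides-injective (inj₂ i) (inj₂ j) eq = cong inj₂ (ys-inj eq)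

-- Each a is sent to K a itself if K a survives in C', and otherwise to the image of K a
-- under the injection C ∖ C' → C' ∖ C; both land in Y, and the two kinds of images
-- cannot collide since only the latter lie outside C.
diffLeq⇒≤ : {H : Hypergraph} {C C' : EdgeSet H} {k m : ℕ} → DecidableEquality (E H) →
            (K : Vector (E H) k) → Injective _≡_ _≡_ K → (∀ a → C (K a)) →
            (Y : Vector (E H) m) → (∀ a → C' (K a) → K a ∈ᵛ Y) →
            (∀ e → C' e → ¬ C e → e ∈ᵛ Y) →
            DiffLeq H C C' → k ≤ m
diffLeq⇒≤ {H} {C} {C'} {k} {m} _≟ₑ_ K K-injective K⊆C Y K∩C'⊆Y C'∖C⊆Y (f , f-injective) =
  injective⇒≤ {f = proj₁ ∘ witness} λ {a} {b} same →
    witness-unique (proj₂ (witness a)) (subst (Witness b) (sym same) (proj₂ (witness b)))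
  where
  data Witness (a : Fin k) (j : Fin m) : Set where
    kept  : K a ≡ Y j → Witness a j
    moved : (c : C (K a)) (q : ¬ C' (K a)) → proj₁ (f (K a) c q) ≡ Y j → ¬ C (Y j) → Witness a j

  witness : ∀ a → Σ (Fin m) (Witness a)
  witness a with any (K a ≟ₑ_) Y
  ... | yes (j , Ka≡Yj) = j , kept Ka≡Yj
  ... | no Ka∉Y =
    let q = Ka∉Y ∘ K∩C'⊆Y a
        (e' , e'∈C' , e'∉C) = f (K a) (K⊆C a) q
        (j , e'≡Yj) = C'∖C⊆Y e' e'∈C' e'∉C
    in j , moved (K⊆C a) q e'≡Yj (subst (¬_ ∘ C) e'≡Yj e'∉C)

  witness-unique : ∀ {a b j} → Witness a j → Witness b j → a ≡ b
  witness-unique (kept p)          (kept p')          = K-injective (trans p (sym p'))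
  witness-unique {a} (kept p)      (moved _ _ _ Yj∉C) = contradiction (subst C p (K⊆C a)) Yj∉C
  witness-unique {b = b} (moved _ _ _ Yj∉C) (kept p') = contradiction (subst C p' (K⊆C b)) Yj∉C
  witness-unique (moved c q p _)   (moved c' q' p' _) =
    K-injective (f-injective _ c q _ c' q' (trans p (sym p')))

diagonal : (n : ℕ) → Vector (ℕ × ℕ) (suc n)
diagonal n j = toℕ j , n ∸ toℕ j

diagonal-injective : ∀ {n} → Injective _≡_ _≡_ (diagonal n)
diagonal-injective eq = toℕ-injective (cong proj₁ eq)

diagonal-sum : ∀ n j → uncurry _+_ (diagonal n j) ≡ n
diagonal-sum n j = m+[n∸m]≡n (≤-pred (toℕ<n j))

diagonal-complete : ∀ {i d n} → i + d ≡ n → (i , d) ∈ᵛ diagonal n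
diagonal-complete {i} {d} refl =
  fromℕ< i<1+i+d ,
  cong₂ _,_ (sym (toℕ-fromℕ< i<1+i+d))
            (trans (sym (m+n∸m≡n i d)) (cong (i + d ∸_) (sym (toℕ-fromℕ< i<1+i+d))))
  where
  i<1+i+d : i < suc (i + d)
  i<1+i+d = s≤s (m≤m+n i d)

data Vertex : Set where
  U R : ℕ → Vertex
  S T : ℕ → ℕ → Vertex

data Edge : Set where
  A B : ℕ → ℕ → Edge

infix 4 _∈ₑ_

data _∈ₑ_ : Vertex → Edge → Set where
  S∈A : ∀ {i d} → S i d ∈ₑ A i d
  T∈A : ∀ {i d} → T i d ∈ₑ A i d
  R∈A : ∀ {i d} → R (i + d) ∈ₑ A i d
  T∈B : ∀ {i d} → T i d ∈ₑ B i d
  R∈B : ∀ {i} → R i ∈ₑ B i 0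
  S∈B : ∀ {i d} → S (suc i) d ∈ₑ B i (suc d)
  U∈B : ∀ {i d} → U i ∈ₑ B i d

coords : Edge → ℕ × ℕ
coords (A i d) = i , d
coords (B i d) = i , d

level : Edge → ℕ
level = uncurry _+_ ∘ coords

twin : Edge → Edge
twin (A i d) = B i d
twin (B i d) = A i d

coords-twin : ∀ e → coords (twin e) ≡ coords e
coords-twin (A i d) = refl
coords-twin (B i d) = refl

twin-≢ : ∀ e → twin e ≢ e
twin-≢ (A i d) ()
twin-≢ (B i d) ()

T∈-inv : ∀ {i d e} → T i d ∈ₑ e → e ≡ A i d ⊎ e ≡ B i d
T∈-inv T∈A = inj₁ refl
T∈-inv T∈B = inj₂ refl

_≟ₑ_ : DecidableEquality Edge
A i d ≟ₑ A i' d' = map′ (cong (uncurry A)) (cong coords) (≡-dec _≟_ _≟_ (i , d) (i' , d'))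
B i d ≟ₑ B i' d' = map′ (cong (uncurry B)) (cong coords) (≡-dec _≟_ _≟_ (i , d) (i' , d'))
A _ _ ≟ₑ B _ _ = no λ ()
B _ _ ≟ₑ A _ _ = no λ ()

-- T i d lies only in A i d and B i d, and U i separates B i d from A i d.
edge-ext : ∀ e e' → (∀ v → (v ∈ₑ e) ⇔ (v ∈ₑ e')) → e ≡ e'
edge-ext (A i d) e' same with T∈-inv (Equivalence.to (same (T i d)) T∈A)
... | inj₁ refl = refl
... | inj₂ refl = contradiction (Equivalence.from (same (U i)) U∈B) λ ()
edge-ext (B i d) e' same with T∈-inv (Equivalence.to (same (T i d)) T∈B)
... | inj₁ refl = contradiction (Equivalence.to (same (U i)) U∈B) λ ()
... | inj₂ refl = refl

H₂ : Hypergraph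
H₂ = record { V = Vertex ; E = Edge ; _∈ₕ_ = _∈ₑ_ ; edges-are-sets = edge-ext }

H₂-three-uniform : ThreeUniform H₂
H₂-three-uniform (A i d) =
  S i d , T i d , R (i + d) , (λ ()) , (λ ()) , (λ ()) , λ v → mk⇔
    (λ { S∈A → inj₁ refl ; T∈A → inj₂ (inj₁ refl) ; R∈A → inj₂ (inj₂ refl) })
    (λ { (inj₁ refl) → S∈A ; (inj₂ (inj₁ refl)) → T∈A ; (inj₂ (inj₂ refl)) → R∈A })
H₂-three-uniform (B i zero) =
  T i 0 , R i , U i , (λ ()) , (λ ()) , (λ ()) , λ v → mk⇔
    (λ { T∈B → inj₁ refl ; R∈B → inj₂ (inj₁ refl) ; U∈B → inj₂ (inj₂ refl) })
    (λ { (inj₁ refl) → T∈B ; (inj₂ (inj₁ refl)) → R∈B ; (inj₂ (inj₂ refl)) → U∈B })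
H₂-three-uniform (B i (suc d)) =
  T i (suc d) , S (suc i) d , U i , (λ ()) , (λ ()) , (λ ()) , λ v → mk⇔
    (λ { T∈B → inj₁ refl ; S∈B → inj₂ (inj₁ refl) ; U∈B → inj₂ (inj₂ refl) })
    (λ { (inj₁ refl) → T∈B ; (inj₂ (inj₁ refl)) → S∈B ; (inj₂ (inj₂ refl)) → U∈B })

H₂-no-isolated : NoIsolated H₂
H₂-no-isolated (U i)   = B i 0 , U∈B
H₂-no-isolated (R n)   = B n 0 , R∈B
H₂-no-isolated (S i d) = A i d , S∈A
H₂-no-isolated (T i d) = A i d , T∈A

Covered : EdgeSet H₂ → Vertex → Set
Covered Y v = Σ Edge λ e → Y e × v ∈ₑ e

record Crowded (C : EdgeSet H₂) (n : ℕ) : Set where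
  field
    edges           : Vector Edge (2 + n)
    edges-injective : Injective _≡_ _≡_ edges
    edges⊆C         : ∀ a → C (edges a)
    edges-level     : ∀ a → level (edges a) ≡ n

open Crowded

module _ {C : EdgeSet H₂} (C-covers : IsEdgeCover H₂ C) where

  U-covered : ∀ i → Σ ℕ λ d → C (B i d)
  U-covered i with C-covers (U i)
  ... | _ , B∈C , U∈B {d = d} = d , B∈C

  chosen : ℕ × ℕ → Edge
  chosen (i , d) = proj₁ (C-covers (T i d))

  chosen∈C : ∀ p → C (chosen p)
  chosen∈C (i , d) = proj₁ (proj₂ (C-covers (T i d)))

  chosen-cases : ∀ i d → chosen (i , d) ≡ A i d ⊎ chosen (i , d) ≡ B i d
  chosen-cases i d = T∈-inv (proj₂ (proj₂ (C-covers (T i d))))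

  coords-chosen : ∀ p → coords (chosen p) ≡ p
  coords-chosen (i , d) = [ cong coords , cong coords ]′ (chosen-cases i d)

  chosen-injective : ∀ {p q} → chosen p ≡ chosen q → p ≡ q
  chosen-injective {p} {q} eq =
    trans (sym (coords-chosen p)) (trans (cong coords eq) (coords-chosen q))

  twin-chosen≢chosen : ∀ p q → twin (chosen p) ≢ chosen q
  twin-chosen≢chosen p q eq
    with trans (sym (coords-chosen p))
               (trans (sym (coords-twin (chosen p))) (trans (cong coords eq) (coords-chosen q)))
  ... | refl = twin-≢ (chosen p) eq

  level-chosen : ∀ p → level (chosen p) ≡ uncurry _+_ p
  level-chosen p = cong (uncurry _+_) (coords-chosen p)

  Surplus : ℕ → Set
  Surplus n = Σ (ℕ × ℕ) λ p → uncurry _+_ p ≡ n × C (twin (chosen p))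

  surplus : ∀ i d → C (B i d) → Surplus (i + d)
  S-surplus : ∀ i d → chosen (i , d) ≡ B i d → Covered C (S i d) → Surplus (i + d)

  surplus i d B∈C with chosen-cases i d
  ... | inj₁ chosen≡A = (i , d) , refl , subst (C ∘ twin) (sym chosen≡A) B∈C
  ... | inj₂ chosen≡B = S-surplus i d chosen≡B (C-covers (S i d))

  S-surplus i d chosen≡B (_ , A∈C , S∈A) = (i , d) , refl , subst (C ∘ twin) (sym chosen≡B) A∈C
  S-surplus (suc i) d _ (_ , B∈C , S∈B) = subst Surplus (+-suc i d) (surplus i (suc d) B∈C)

  crowded : ∀ {n} → Surplus n → Crowded C n
  crowded {n} (p , p-level , twin∈C) = record
    { edges           = twin (chosen p) ∷ chosen ∘ diagonal n
    ; edges-injective = injective-∷ (twin-chosen≢chosen p ∘ diagonal n)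
                                     (diagonal-injective ∘ chosen-injective)
    ; edges⊆C         = λ { fzero → twin∈C ; (fsuc j) → chosen∈C (diagonal n j) }
    ; edges-level     = λ
        { fzero → trans (cong (uncurry _+_) (coords-twin (chosen p))) (trans (level-chosen p) p-level)
        ; (fsuc j) → trans (level-chosen (diagonal n j)) (diagonal-sum n j) }
    }

module Replacement {n₀ n₁ : ℕ} (n₀<n₁ : n₀ < n₁) where

  replacement : Vector Edge (suc (suc n₀ + suc n₁))
  replacement = A 0 n₁ ∷ uncurry A ∘ diagonal n₀ ++ uncurry B ∘ diagonal n₁

  A∈replacement : ∀ {i d} → i + d ≡ n₀ → A i d ∈ᵛ replacement
  A∈replacement {i} {d} p =
    let (j , ij≡) = diagonal-complete p
    in there {P = A i d ≡_} (∈ᵛ-++⁺ˡ (uncurry B ∘ diagonal n₁) (j , cong (uncurry A) ij≡))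

  B∈replacement : ∀ {i d} → i + d ≡ n₁ → B i d ∈ᵛ replacement
  B∈replacement {i} {d} p =
    let (j , ij≡) = diagonal-complete p
    in there {P = B i d ≡_} (∈ᵛ-++⁺ʳ (uncurry A ∘ diagonal n₀) (j , cong (uncurry B) ij≡))

  level₀-replaceable : ∀ {v} e → level e ≡ n₀ → v ∈ₑ e → Covered (_∈ᵛ replacement) v
  level₀-replaceable (A i d) p v∈A = A i d , A∈replacement p , v∈A
  level₀-replaceable (B i d) p T∈B = A i d , A∈replacement p , T∈A
  level₀-replaceable (B i zero) p R∈B =
    A i 0 , A∈replacement p , subst (λ k → R k ∈ₑ A i 0) (+-identityʳ i) R∈A
  level₀-replaceable (B i (suc d)) p S∈B =
    A (suc i) d , A∈replacement (trans (sym (+-suc i d)) p) , S∈A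
  level₀-replaceable (B i d) p U∈B = B i (n₁ ∸ i) , B∈replacement (m+[n∸m]≡n i≤n₁) , U∈B
    where
    i≤n₁ : i ≤ n₁
    i≤n₁ = ≤-trans (m≤m+n i d) (≤-trans (≤-reflexive p) (<⇒≤ n₀<n₁))

  level₁-replaceable : ∀ {v} e → level e ≡ n₁ → v ∈ₑ e → Covered (_∈ᵛ replacement) v
  level₁-replaceable (B i d) p v∈B = B i d , B∈replacement p , v∈B
  level₁-replaceable (A zero d) p S∈A = A 0 d , (fzero , cong (A 0) p) , S∈A
  level₁-replaceable (A (suc i) d) p S∈A = B i (suc d) , B∈replacement (trans (+-suc i d) p) , S∈B
  level₁-replaceable (A i d) p T∈A = B i d , B∈replacement p , T∈B
  level₁-replaceable (A i d) p R∈A =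
    B (i + d) 0 , B∈replacement (trans (+-identityʳ (i + d)) p) , R∈B

  OnLevels : Edge → Set
  OnLevels e = level e ≡ n₀ ⊎ level e ≡ n₁

  improved : EdgeSet H₂ → EdgeSet H₂
  improved C e = (C e × ¬ OnLevels e) ⊎ e ∈ᵛ replacement

  improved-covers : ∀ {C} → IsEdgeCover H₂ C → IsEdgeCover H₂ (improved C)
  improved-covers covers v with covers v
  ... | e , e∈C , v∈e with level e ≟ n₀ | level e ≟ n₁
  ... | yes p  | _      = map₂ (map₁ inj₂) (level₀-replaceable e p v∈e)
  ... | no _   | yes q  = map₂ (map₁ inj₂) (level₁-replaceable e q v∈e)
  ... | no p̸   | no q̸   = e , inj₁ (e∈C , [ p̸ , q̸ ]) , v∈e

  crowded-levels⇒¬strongly-minimal : ∀ {C} → Crowded C n₀ → Crowded C n₁ →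
                                     ¬ IsStronglyMinimal H₂ C
  crowded-levels⇒¬strongly-minimal {C} c₀ c₁ (covers , minimal) =
    n≮n _ (subst (_≤ suc (suc n₀ + suc n₁)) (cong (suc ∘ suc) (+-suc n₀ (suc n₁))) k≤m)
    where
    K : Vector Edge ((2 + n₀) + (2 + n₁))
    K = edges c₀ ++ edges c₁

    K-on-levels : ∀ a → OnLevels (K a)
    K-on-levels = ++⁺ OnLevels (inj₁ ∘ edges-level c₀) (inj₂ ∘ edges-level c₁)

    levels-disjoint : ∀ a b → edges c₀ a ≢ edges c₁ b
    levels-disjoint a b eq =
      <⇒≢ n₀<n₁ (trans (sym (edges-level c₀ a)) (trans (cong level eq) (edges-level c₁ b)))

    k≤m : (2 + n₀) + (2 + n₁) ≤ suc (suc n₀ + suc n₁)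
    k≤m = diffLeq⇒≤ {H₂} _≟ₑ_ K
      (injective-++ (edges-injective c₀) (edges-injective c₁) levels-disjoint)
      (++⁺ C (edges⊆C c₀) (edges⊆C c₁))
      replacement
      (λ a → [ (λ (_ , off) → contradiction (K-on-levels a) off) , id ]′)
      (λ e → [ (λ (e∈C , _) e∉C → contradiction e∈C e∉C) , (λ e∈Y _ → e∈Y) ]′)
      (minimal (improved C) (improved-covers covers))

H₂-no-strongly-minimal : ∀ C → ¬ IsStronglyMinimal H₂ C
H₂-no-strongly-minimal C strongly-minimal@(covers , _) =
  let (d₀ , B₀∈C) = U-covered covers 0
      (d₁ , B₁∈C) = U-covered covers (suc d₀)
  in Replacement.crowded-levels⇒¬strongly-minimal (s≤s (m≤m+n d₀ d₁))
       (crowded covers (surplus covers 0 d₀ B₀∈C))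
       (crowded covers (surplus covers (suc d₀) d₁ B₁∈C))
       strongly-minimal

theorem1p3 : Σ Hypergraph λ H → ThreeUniform H × NoIsolated H ×
               ¬ (Σ (EdgeSet H) λ C → IsStronglyMinimal H C)
theorem1p3 =
  H₂ , H₂-three-uniform , H₂-no-isolated , λ (C , strongly-minimal) → H₂-no-strongly-minimal C strongly-minimal
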